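{- Let $\pi^*$ and $\tau$ be simple related chromosomes with $dp[\pi^*]=dp[\tau]=2$. Then $\pi^*=\tau$ if and only if $\mathcal{A}[\pi^*]=\mathcal{A}[\tau]$ and every repeat is neighbor-consistent.
   Context: Fix genes $\Sigma_1$ and repeats $\Sigma_2\ni r_0$. A chromosome is a sequence $\pi=[x_0,\dots,x_{n+1}]$ of signed symbols ($x_i=\pm a$, $|x_i|=a$) with $x_0=+r_0$, $x_{n+1}=-r_0$, every gene occurring exactly once. $dp[a,\pi]$ is the number of occurrences of $a$, $dp[\pi]$ its maximum over repeats; related chromosomes have equal duplication numbers. Each occurrence $x_i$ has nodes $l(x_i),r(x_i)$: $(a^h,a^t)$ if $x_i=+a$, $(a^t,a^h)$ if $x_i=-a$. The adjacencies of $\pi$ are the unordered pairs $\langle r(x_i),l(x_{i+1})\rangle$, $0\le i\le n$, each associated with $x_i$ and with $x_{i+1}$; $\mathcal{A}[\pi]$ is their multiset; $\pi$ is simple if no adjacency occurs twice in $\mathcal{A}[\pi]$. Neighbor-consistency (for simple $\pi,\tau$ with $\mathcal{A}[\pi]=\mathcal{A}[\tau]$): identical adjacencies are matched by the unique bijection (the left end of $\pi$ is also regarded as matched to the left end of $\tau$ and the right end to the right end, serving as the missing adjacency of an extremal occurrence). A repeat $x$ with occurrences $x_i,x_j$ in $\pi$ and $y_{i'},y_{j'}$ in $\tau$ is neighbor-consistent if the left and right adjacencies of $x_i$ are matched to two adjacencies both associated with $y_{i'}$ or both associated with $y_{j'}$, and neighbor-inconsistent otherwise; genes and repeats occurring once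 are neighbor-consistent. -}

module Defs where

open import Data.Nat using (ℕ; zero; suc; _≤_; _<_)
import Data.Nat
open import Data.List using (List; []; _∷_; _++_; [_]; length; filter)
open import Data.Product using (Σ; ∃; _×_; _,_; proj₂)
open import Data.Sum using (_⊎_; inj₁; inj₂)
open import Data.Sum.Properties using (≡-dec)
open import Data.Empty using (⊥)
open import Relation.Nullary using (¬_)
open import Relation.Binary using (DecidableEquality; Setoid; IsEquivalence)
open import Relation.Binary.PropositionalEquality using (_≡_; refl; sym; trans)
import Data.List.Relation.Binary.Permutation.Setoid as PermS
import Data.List.Relation.Unary.Unique.Setoid as UniqueS

record Alphabet : Set₁ where
  field
    Gene      : Set
    Repeat    : Set
    _≟G_      : DecidableEquality Gene
    _≟R_      : DecidableEquality Repeat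
    r₀        : Repeat

data Sign : Set where
  plus minus : Sign

data Ext : Set where
  hd tl : Ext

module Theory (A : Alphabet) where
  open Alphabet A

  Sym : Set
  Sym = Gene ⊎ Repeat

  _≟S_ : DecidableEquality Sym
  _≟S_ = ≡-dec _≟G_ _≟R_

  SSym : Set
  SSym = Sign × Sym

  ∣_∣ : SSym → Sym
  ∣ x ∣ = proj₂ x

  Node : Set
  Node = Sym × Ext

  l r : SSym → Node
  l (plus  , a) = a , hd
  l (minus , a) = a , tl
  r (plus  , a) = a , tl
  r (minus , a) = a , hd

  -- an adjacency ⟨u , v⟩ (an unordered pair of nodes)
  data Adj : Set where
    ⟨_,_⟩ : Node → Node → Adj

  _≈ᴬ_ : Adj → Adj → Set
  ⟨ u , v ⟩ ≈ᴬ ⟨ u' , v' ⟩ = (u ≡ u' × v ≡ v') ⊎ (u ≡ v' × v ≡ u')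

  ≈ᴬ-isEquivalence : IsEquivalence _≈ᴬ_
  ≈ᴬ-isEquivalence = record
    { refl  = λ { {⟨ u , v ⟩} → inj₁ (refl , refl) }
    ; sym   = λ { {⟨ _ , _ ⟩} {⟨ _ , _ ⟩} (inj₁ (p , q)) → inj₁ (sym p , sym q)
                ; {⟨ _ , _ ⟩} {⟨ _ , _ ⟩} (inj₂ (p , q)) → inj₂ (sym q , sym p) }
    ; trans = λ { {⟨ _ , _ ⟩} {⟨ _ , _ ⟩} {⟨ _ , _ ⟩} (inj₁ (p , q)) (inj₁ (p' , q')) → inj₁ (trans p p' , trans q q')
                ; {⟨ _ , _ ⟩} {⟨ _ , _ ⟩} {⟨ _ , _ ⟩} (inj₁ (p , q)) (inj₂ (p' , q')) → inj₂ (trans p p' , trans q q')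
                ; {⟨ _ , _ ⟩} {⟨ _ , _ ⟩} {⟨ _ , _ ⟩} (inj₂ (p , q)) (inj₁ (p' , q')) → inj₂ (trans p q' , trans q p')
                ; {⟨ _ , _ ⟩} {⟨ _ , _ ⟩} {⟨ _ , _ ⟩} (inj₂ (p , q)) (inj₂ (p' , q')) → inj₁ (trans p q' , trans q p') }
    }

  AdjSetoid : Setoid _ _
  AdjSetoid = record { Carrier = Adj ; _≈_ = _≈ᴬ_ ; isEquivalence = ≈ᴬ-isEquivalence }

  adj : SSym → SSym → Adj
  adj x y = ⟨ r x , l y ⟩

  adjs : List SSym → List Adj
  adjs (x ∷ y ∷ rest) = adj x y ∷ adjs (y ∷ rest)
  adjs _              = []

  -- multiset equality 𝒜[π] = 𝒜[τ] (permutation up to unordered-pair equality)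
  SameAdj : List SSym → List SSym → Set
  SameAdj π τ = PermS._↭_ AdjSetoid (adjs π) (adjs τ)

  Simple : List SSym → Set
  Simple π = UniqueS.Unique AdjSetoid (adjs π)

  dp : Sym → List SSym → ℕ
  dp a π = length (filter (λ x → ∣ x ∣ ≟S a) π)

  Chromosome : List SSym → Set
  Chromosome π =
    (∃ λ (mid : List SSym) → π ≡ (plus , inj₂ r₀) ∷ mid ++ [ (minus , inj₂ r₀) ])
    × (∀ (g : Gene) → dp (inj₁ g) π ≡ 1)

  Related : List SSym → List SSym → Set
  Related π τ = ∀ (a : Sym) → dp a π ≡ dp a τ

  -- dp[π] = 2: the maximum over repeats of dp[a, π] equals 2
  DpIs2 : List SSym → Set
  DpIs2 π = (∀ (a : Repeat) → dp (inj₂ a) π ≤ 2) × (∃ λ (a : Repeat) → dp (inj₂ a) π ≡ 2)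

  -- xs at i ≡ y : the i-th entry (0-based) of xs is y
  _at_≡_ : {X : Set} → List X → ℕ → X → Set
  []       at _     ≡ _ = ⊥
  (x ∷ xs) at zero  ≡ y = x ≡ y
  (x ∷ xs) at suc i ≡ y = xs at i ≡ y

  OccAt : List SSym → ℕ → Sym → Set
  OccAt π i a = ∃ λ (s : Sign) → π at i ≡ (s , a)

  -- For π = [x₀,…,x_{L-1}] (L = n+2), slot s ∈ {0,…,L} lies just
  -- left of x_s: slot 0 is the left end, slot L the right end, and an
  -- inner slot s = k+1 is the adjacency ⟨r(x_k), l(x_{k+1})⟩ (k-th entry of
  -- adjs π).  The left adjacency of x_i is slot i, its right adjacency slot i+1.

  Assoc : ℕ → ℕ → Set
  Assoc t p = (t ≡ p) ⊎ (t ≡ suc p)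

  Matched : List SSym → List SSym → ℕ → ℕ → Set
  Matched π τ s t =
    (s ≡ 0 × t ≡ 0)
    ⊎ (s ≡ length π × t ≡ length τ)
    ⊎ (∃ λ (k : ℕ) → ∃ λ (k' : ℕ) → ∃ λ (p : Adj) → ∃ λ (q : Adj) →
         s ≡ suc k × t ≡ suc k' × adjs π at k ≡ p × adjs τ at k' ≡ q × p ≈ᴬ q)

  -- the repeat a is neighbor-consistent (w.r.t. π, τ): whenever a has
  -- occurrences x_i, x_j (i < j) in π and y_{i'}, y_{j'} (i' < j') in τ, the
  -- left and right adjacencies of x_i are matched to adjacencies both
  -- associated with y_{i'} or both associated with y_{j'}.
  -- (Vacuous for symbols occurring at most once.)
  NeighborConsistent : List SSym → List SSym → Repeat → Set
  NeighborConsistent π τ a =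
    ∀ (i j i' j' : ℕ) → i Data.Nat.< j → i' Data.Nat.< j' →
    OccAt π i (inj₂ a) → OccAt π j (inj₂ a) →
    OccAt τ i' (inj₂ a) → OccAt τ j' (inj₂ a) →
    ∀ (t₁ t₂ : ℕ) → Matched π τ i t₁ → Matched π τ (suc i) t₂ →
    (Assoc t₁ i' × Assoc t₂ i') ⊎ (Assoc t₁ j' × Assoc t₂ j')

-- Reconstruct π from 𝒜[π] position by position.  Suppose π and τ agree on
-- x₀, …, x_k.  The adjacency ⟨r(x_k), l(x_{k+1})⟩ of π occurs in τ at some
-- index m.  Simplicity rules out m < k, since there τ's adjacency is also
-- one of π's earlier ones; m = k pins down y_{k+1} = x_{k+1}.  If m > k,
-- then |x_k| occurs in τ after position k, so by dp ≤ 2 and relatedness it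
-- also occurs in π after k; it is then a repeat (genes occur once) whose
-- occurrence x_k has its left adjacency matched to slot k of τ and its right
-- adjacency to slot m + 1 > k + 1, contradicting neighbor-consistency.
-- Conversely, for π = τ simplicity makes the matching the identity on slots,
-- and dp ≤ 2 makes the first occurrences of each repeat coincide.
module Submission where

open import Defs
open import Data.Nat using (ℕ; zero; suc; _≤_; _<_; z≤n; s≤s)
open import Data.Nat.Properties
  using ( ≤-refl; ≤-trans; <-irrefl; <⇒≤; <⇒≢; n≤1+n; <-cmp; _<?_; ≮⇒≥; <-≤-trans
        ; m<n⇒m<1+n; suc-injective; m≤n⇒m<n∨m≡n)
open import Data.List using (List; []; _∷_; length)
open import Data.List.Relation.Unary.All using (All; _∷_)
open import Data.List.Relation.Unary.Any using (here; there)
open import Data.List.Relation.Unary.AllPairs using (_∷_)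
open import Data.Product using (∃; ∃₂; _×_; _,_; proj₁)
open import Data.Sum using (_⊎_; inj₁; inj₂)
open import Data.Empty using (⊥; ⊥-elim)
open import Function.Bundles using (_⇔_; mk⇔)
open import Level using (0ℓ)
open import Relation.Binary using (Setoid; tri<; tri≈; tri>)
open import Relation.Binary.PropositionalEquality
  using (_≡_; refl; sym; trans; cong; subst)
open import Relation.Nullary using (¬_; yes; no)
import Data.List.Membership.Setoid as SetoidMembership
import Data.List.Relation.Unary.Unique.Setoid as SetoidUnique
import Data.List.Relation.Binary.Permutation.Setoid as SetoidPermutation
import Data.List.Relation.Binary.Permutation.Setoid.Properties as SetoidPermutationProperties

module _ (𝔸 : Alphabet) where
  open Alphabet 𝔸
  open Theory 𝔸

  module _ {X : Set} where

    at-functional : ∀ (xs : List X) p {y y'} → xs at p ≡ y → xs at p ≡ y' → y ≡ y'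
    at-functional (_ ∷ _)  zero    e e' = trans (sym e) e'
    at-functional (_ ∷ xs) (suc p) e e' = at-functional xs p e e'

    at-≤ : ∀ (xs : List X) {p q y} → p ≤ q → xs at q ≡ y → ∃ λ x → xs at p ≡ x
    at-≤ (x ∷ _)  {zero}          _         _ = x , refl
    at-≤ (_ ∷ xs) {suc p} {suc q} (s≤s p≤q) e = at-≤ xs p≤q e

    at-pointwise⇒≡ : ∀ (xs ys : List X) → (∀ {p y} → xs at p ≡ y → ys at p ≡ y) →
                     length xs ≡ length ys → xs ≡ ys
    at-pointwise⇒≡ []       []       _  _  = refl
    at-pointwise⇒≡ (x ∷ xs) []       xs⊆ _ = ⊥-elim (xs⊆ {0} refl)
    at-pointwise⇒≡ (x ∷ xs) (y ∷ ys) xs⊆ |xs|≡|ys| with xs⊆ {0} refl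
    ... | refl = cong (x ∷_) (at-pointwise⇒≡ xs ys (λ {p} → xs⊆ {suc p}) (suc-injective |xs|≡|ys|))

  module _ {ℓ} (S : Setoid 0ℓ ℓ) where
    open Setoid S using (_≈_) renaming (Carrier to C; refl to ≈-refl; sym to ≈-sym)
    open SetoidMembership S using (_∈_)
    open SetoidUnique S using (Unique)

    ∈⇒at : ∀ {x : C} {xs} → x ∈ xs → ∃₂ λ m y → (xs at m ≡ y) × x ≈ y
    ∈⇒at (here x≈y)  = 0 , _ , refl , x≈y
    ∈⇒at (there x∈xs) with ∈⇒at x∈xs
    ... | m , y , e , x≈y = suc m , y , e , x≈y

    at⇒∈ : ∀ {xs : List C} m {y} → xs at m ≡ y → y ∈ xs
    at⇒∈ {_ ∷ _}  zero    refl = here ≈-refl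
    at⇒∈ {_ ∷ xs} (suc m) e    = there (at⇒∈ {xs} m e)

    private
      All-at : ∀ {p} {P : C → Set p} {xs} m {y} → All P xs → xs at m ≡ y → P y
      All-at zero    (px ∷ _)   refl = px
      All-at (suc m) (_  ∷ pxs) e    = All-at m pxs e

    unique⇒at-injective : ∀ {xs} → Unique xs → ∀ m n {y z} →
                          xs at m ≡ y → xs at n ≡ z → y ≈ z → m ≡ n
    unique⇒at-injective {_ ∷ _}  _           zero    zero    _    _    _   = refl
    unique⇒at-injective {_ ∷ _}  (x≉ ∷ _)    zero    (suc n) refl e'   y≈z = ⊥-elim (All-at n x≉ e' y≈z)
    unique⇒at-injective {_ ∷ _}  (x≉ ∷ _)    (suc m) zero    e    refl y≈z = ⊥-elim (All-at m x≉ e (≈-sym y≈z))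
    unique⇒at-injective {_ ∷ xs} (_ ∷ uniq) (suc m) (suc n) e    e'   y≈z =
      cong suc (unique⇒at-injective uniq m n e e' y≈z)

  open Setoid AdjSetoid using () renaming (refl to ≈ᴬ-refl; sym to ≈ᴬ-sym)
  open SetoidPermutationProperties AdjSetoid using (xs↭ys⇒|xs|≡|ys|; ∈-resp-↭)

  l-injective : ∀ {x y : SSym} → l x ≡ l y → x ≡ y
  l-injective {plus  , _} {plus  , _} refl = refl
  l-injective {minus , _} {minus , _} refl = refl

  r-injective : ∀ {x y : SSym} → r x ≡ r y → x ≡ y
  r-injective {plus  , _} {plus  , _} refl = refl
  r-injective {minus , _} {minus , _} refl = refl

  r≡l⇒∣∣≡ : ∀ {x y : SSym} → r x ≡ l y → ∣ x ∣ ≡ ∣ y ∣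
  r≡l⇒∣∣≡ {plus  , _} {minus , _} refl = refl
  r≡l⇒∣∣≡ {minus , _} {plus  , _} refl = refl

  adj-cancelˡ : ∀ {x y z} → adj x y ≈ᴬ adj x z → y ≡ z
  adj-cancelˡ (inj₁ (_ , ly≡lz))     = l-injective ly≡lz
  adj-cancelˡ (inj₂ (rx≡lz , ly≡rx)) = l-injective (trans ly≡rx rx≡lz)

  adj-≈⇒∣∣≡ : ∀ {x y z w} → adj x y ≈ᴬ adj z w → ∣ x ∣ ≡ ∣ z ∣ ⊎ ∣ x ∣ ≡ ∣ w ∣
  adj-≈⇒∣∣≡ (inj₁ (rx≡rz , _)) = inj₁ (cong ∣_∣ (r-injective rx≡rz))
  adj-≈⇒∣∣≡ (inj₂ (rx≡lw , _)) = inj₂ (r≡l⇒∣∣≡ rx≡lw)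

  at-adjs⁻ : ∀ xs m {q} → adjs xs at m ≡ q →
             ∃₂ λ z w → (xs at m ≡ z) × (xs at suc m ≡ w) × q ≡ adj z w
  at-adjs⁻ (_ ∷ _ ∷ _)  zero    e = _ , _ , refl , refl , sym e
  at-adjs⁻ (_ ∷ y ∷ xs) (suc m) e = at-adjs⁻ (y ∷ xs) m e

  at-adjs⁺ : ∀ xs m {z w} → xs at m ≡ z → xs at suc m ≡ w → adjs xs at m ≡ adj z w
  at-adjs⁺ (_ ∷ _ ∷ _)  zero    refl refl = refl
  at-adjs⁺ (_ ∷ y ∷ xs) (suc m) e    e'   = at-adjs⁺ (y ∷ xs) m e e'

  length-adjs-∷ : ∀ x xs → length (adjs (x ∷ xs)) ≡ length xs
  length-adjs-∷ x []       = refl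
  length-adjs-∷ x (y ∷ xs) = cong suc (length-adjs-∷ y xs)

  dp-∷-≥ : ∀ a x xs → dp a xs ≤ dp a (x ∷ xs)
  dp-∷-≥ a x xs with ∣ x ∣ ≟S a
  ... | yes _ = n≤1+n _
  ... | no  _ = ≤-refl

  dp-∷-here : ∀ a s xs → dp a ((s , a) ∷ xs) ≡ suc (dp a xs)
  dp-∷-here a s xs with a ≟S a
  ... | yes _ = refl
  ... | no a≢a = ⊥-elim (a≢a refl)

  occ⇒1≤dp : ∀ {a} xs i → OccAt xs i a → 1 ≤ dp a xs
  occ⇒1≤dp {a} (x ∷ xs) zero    (s , refl) rewrite dp-∷-here a s xs = s≤s z≤n
  occ⇒1≤dp {a} (x ∷ xs) (suc i) occ = ≤-trans (occ⇒1≤dp xs i occ) (dp-∷-≥ a x xs)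

  occ²⇒2≤dp : ∀ {a} xs i j → i < j → OccAt xs i a → OccAt xs j a → 2 ≤ dp a xs
  occ²⇒2≤dp {a} (x ∷ xs) zero (suc j) _ (s , refl) oj rewrite dp-∷-here a s xs =
    s≤s (occ⇒1≤dp xs j oj)
  occ²⇒2≤dp {a} (x ∷ xs) (suc i) (suc j) (s≤s i<j) oi oj =
    ≤-trans (occ²⇒2≤dp xs i j i<j oi oj) (dp-∷-≥ a x xs)

  occ³⇒3≤dp : ∀ {a} xs i j k → i < j → j < k →
              OccAt xs i a → OccAt xs j a → OccAt xs k a → 3 ≤ dp a xs
  occ³⇒3≤dp {a} (x ∷ xs) zero (suc j) (suc k) _ (s≤s j<k) (s , refl) oj ok
    rewrite dp-∷-here a s xs = s≤s (occ²⇒2≤dp xs j k j<k oj ok)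
  occ³⇒3≤dp {a} (x ∷ xs) (suc i) (suc j) (suc k) (s≤s i<j) (s≤s j<k) oi oj ok =
    ≤-trans (occ³⇒3≤dp xs i j k i<j j<k oi oj ok) (dp-∷-≥ a x xs)

  1≤dp⇒occ : ∀ {a} xs → 1 ≤ dp a xs → ∃ λ i → OccAt xs i a
  1≤dp⇒occ {a} ((s , b) ∷ xs) 1≤dp with b ≟S a
  ... | yes refl = 0 , s , refl
  ... | no  _    = let i , oi = 1≤dp⇒occ xs 1≤dp in suc i , oi

  2≤dp⇒occ² : ∀ {a} xs → 2 ≤ dp a xs → ∃₂ λ i j → i < j × OccAt xs i a × OccAt xs j a
  2≤dp⇒occ² {a} ((s , b) ∷ xs) 2≤dp with b ≟S a
  2≤dp⇒occ² {a} ((s , b) ∷ xs) (s≤s 1≤dp) | yes refl =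
    let j , oj = 1≤dp⇒occ xs 1≤dp in 0 , suc j , s≤s z≤n , (s , refl) , oj
  2≤dp⇒occ² {a} ((s , b) ∷ xs) 2≤dp | no _ =
    let i , j , i<j , oi , oj = 2≤dp⇒occ² xs 2≤dp in suc i , suc j , s≤s i<j , oi , oj

  dp≤2⇒¬occ³ : ∀ {a} xs {i j k} → dp a xs ≤ 2 → i < j → j < k →
               OccAt xs i a → OccAt xs j a → OccAt xs k a → ⊥
  dp≤2⇒¬occ³ xs {i} {j} {k} dp≤2 i<j j<k oi oj ok
    with ≤-trans (occ³⇒3≤dp xs i j k i<j j<k oi oj ok) dp≤2
  ... | s≤s (s≤s ())

  dp≤2⇒third-occ∈ : ∀ {a} xs {i j k} → dp a xs ≤ 2 → i < j →
                    OccAt xs i a → OccAt xs j a → OccAt xs k a → k ≡ i ⊎ k ≡ j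
  dp≤2⇒third-occ∈ xs {i} {j} {k} dp≤2 i<j oi oj ok with <-cmp k i | <-cmp k j
  ... | tri≈ _ k≡i _ | _            = inj₁ k≡i
  ... | _            | tri≈ _ k≡j _ = inj₂ k≡j
  ... | tri< k<i _ _ | _            = ⊥-elim (dp≤2⇒¬occ³ xs dp≤2 k<i i<j ok oi oj)
  ... | tri> _ _ i<k | tri< k<j _ _ = ⊥-elim (dp≤2⇒¬occ³ xs dp≤2 i<k k<j oi ok oj)
  ... | _            | tri> _ _ j<k = ⊥-elim (dp≤2⇒¬occ³ xs dp≤2 i<j j<k oi oj ok)

  adj-≈-at⇒occ : ∀ xs m {x y q} → adjs xs at m ≡ q → adj x y ≈ᴬ q →
                 OccAt xs m ∣ x ∣ ⊎ OccAt xs (suc m) ∣ x ∣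
  adj-≈-at⇒occ xs m xsadj A≈q with at-adjs⁻ xs m xsadj
  ... | (s , _) , (s' , _) , xsm , xsm₊₁ , refl with adj-≈⇒∣∣≡ A≈q
  ...   | inj₁ x≡z = inj₁ (subst (OccAt xs m) (sym x≡z) (s , xsm))
  ...   | inj₂ x≡w = inj₂ (subst (OccAt xs (suc m)) (sym x≡w) (s' , xsm₊₁))

  chromosome-head : ∀ {π} → Chromosome π → π at 0 ≡ (plus , inj₂ r₀)
  chromosome-head ((_ , refl) , _) = refl

  chromosome-gene-once : ∀ {π i j g} → Chromosome π → i < j →
                         OccAt π i (inj₁ g) → OccAt π j (inj₁ g) → ⊥
  chromosome-gene-once {π} {i} {j} {g} (_ , once) i<j oi oj
    with subst (2 ≤_) (once g) (occ²⇒2≤dp π i j i<j oi oj)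
  ... | s≤s ()

  sameAdj-∷⇒length≡ : ∀ {x y} xs ys → SameAdj (x ∷ xs) (y ∷ ys) →
                      length (x ∷ xs) ≡ length (y ∷ ys)
  sameAdj-∷⇒length≡ {x} {y} xs ys 𝒜π↭𝒜τ =
    cong suc (trans (sym (length-adjs-∷ x xs))
                    (trans (xs↭ys⇒|xs|≡|ys| 𝒜π↭𝒜τ) (length-adjs-∷ y ys)))

  chromosome-sameAdj⇒length≡ : ∀ {π τ} → Chromosome π → Chromosome τ → SameAdj π τ →
                               length π ≡ length τ
  chromosome-sameAdj⇒length≡ ((_ , refl) , _) ((_ , refl) , _) = sameAdj-∷⇒length≡ _ _

  matched-self⇒≡ : ∀ {π s t} → Simple π → Matched π π s t → s ≡ t
  matched-self⇒≡ _ (inj₁ (refl , refl))         = refl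
  matched-self⇒≡ _ (inj₂ (inj₁ (s≡L , t≡L)))    = trans s≡L (sym t≡L)
  matched-self⇒≡ simple (inj₂ (inj₂ (k , k' , _ , _ , refl , refl , atk , atk' , p≈q))) =
    cong suc (unique⇒at-injective AdjSetoid simple k k' atk atk' p≈q)

  -- With dp ≤ 2 the first occurrences coincide: i' = i.
  neighborConsistent-refl : ∀ {π a} → Simple π → dp (inj₂ a) π ≤ 2 → NeighborConsistent π π a
  neighborConsistent-refl {π} simple dp≤2 i j i' j' i<j i'<j' oi oj oi' oj' t₁ t₂ mᵢ mᵢ₊₁
    with dp≤2⇒third-occ∈ π dp≤2 i<j oi oj oi'
  ... | inj₁ refl =
    inj₁ (inj₁ (sym (matched-self⇒≡ simple mᵢ)) , inj₂ (sym (matched-self⇒≡ simple mᵢ₊₁)))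
  ... | inj₂ refl = ⊥-elim (dp≤2⇒¬occ³ π dp≤2 i<j i'<j' oi oj oj')

  module Reconstruction
    {π τ : List SSym} (cπ : Chromosome π) (cτ : Chromosome τ) (simple : Simple π)
    (related : Related π τ) (dpτ≤2 : ∀ a → dp (inj₂ a) τ ≤ 2)
    (𝒜π↭𝒜τ : SameAdj π τ) (consistent : ∀ a → NeighborConsistent π τ a) where

    AgreeUpTo : ℕ → Set
    AgreeUpTo k = ∀ {p y} → p ≤ k → π at p ≡ y → τ at p ≡ y

    agree-reflect : ∀ {k x p y} → AgreeUpTo k → π at k ≡ x → p ≤ k → τ at p ≡ y → π at p ≡ y
    agree-reflect {p = p} agree πk p≤k τp with at-≤ π p≤k πk
    ... | _ , πp = subst (λ v → π at p ≡ v) (at-functional τ p (agree p≤k πp) τp) πp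

    agree-occ : ∀ {k p a} → AgreeUpTo k → p ≤ k → OccAt π p a → OccAt τ p a
    agree-occ agree p≤k (s , πp) = s , agree p≤k πp

    agree⇒matched-diagonal : ∀ {k x} → AgreeUpTo k → π at k ≡ x → Matched π τ k k
    agree⇒matched-diagonal {zero}  _     _      = inj₁ (refl , refl)
    agree⇒matched-diagonal {suc k} agree πk₊₁ with at-≤ π (n≤1+n k) πk₊₁
    ... | _ , πk = inj₂ (inj₂ (k , k , _ , _ , refl , refl , at-adjs⁺ π k πk πk₊₁ ,
                               at-adjs⁺ τ k (agree (n≤1+n k) πk) (agree ≤-refl πk₊₁) , ≈ᴬ-refl))

    agree⇒adjs-agree : ∀ {k x m q} → AgreeUpTo k → π at k ≡ x → m < k →
                       adjs τ at m ≡ q → adjs π at m ≡ q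
    agree⇒adjs-agree {m = m} agree πk m<k τadj with at-adjs⁻ τ m τadj
    ... | _ , _ , τm , τm₊₁ , refl =
      at-adjs⁺ π m (agree-reflect agree πk (<⇒≤ m<k) τm) (agree-reflect agree πk m<k τm₊₁)

    -- Below slot k the adjacencies of τ are those of π, so simplicity of π forces m = k.
    matched-index-not-before : ∀ {k x x' m q} → AgreeUpTo k → π at k ≡ x → π at suc k ≡ x' →
                               adjs τ at m ≡ q → adj x x' ≈ᴬ q → ¬ m < k
    matched-index-not-before {k} {m = m} agree πk πk₊₁ τadj A≈q m<k =
      <-irrefl (unique⇒at-injective AdjSetoid simple m k (agree⇒adjs-agree agree πk m<k τadj)
                                    (at-adjs⁺ π k πk πk₊₁) (≈ᴬ-sym A≈q))
               m<k

    later-occurrence-in-π : ∀ {k o a} → AgreeUpTo k → OccAt τ k (inj₂ a) → k < o →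
                            OccAt τ o (inj₂ a) → ∃ λ j → k < j × OccAt π j (inj₂ a)
    later-occurrence-in-π {k} {o} {a} agree τk k<o τo with 2≤dp⇒occ² π 2≤dpπ
      where 2≤dpπ = subst (2 ≤_) (sym (related (inj₂ a))) (occ²⇒2≤dp τ k o k<o τk τo)
    ... | i , j , i<j , πi , πj with k <? j
    ...   | yes k<j = j , k<j , πj
    ...   | no  k≮j = ⊥-elim (dp≤2⇒¬occ³ τ (dpτ≤2 a) i<k k<o (agree-occ agree (<⇒≤ i<k) πi) τk τo)
      where i<k = <-≤-trans i<j (≮⇒≥ k≮j)

    no-later-occurrence : ∀ {k s a x' m q o} → AgreeUpTo k → π at k ≡ (s , a) → π at suc k ≡ x' →
                          adjs τ at m ≡ q → adj (s , a) x' ≈ᴬ q → k < m → k < o → OccAt τ o a → ⊥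
    no-later-occurrence {a = inj₁ _} agree πk _ _ _ _ k<o τo =
      chromosome-gene-once cτ k<o (_ , agree ≤-refl πk) τo
    no-later-occurrence {k} {s} {inj₂ a} {m = m} {o = o} agree πk πk₊₁ τadj A≈q k<m k<o τo
      with later-occurrence-in-π agree (s , agree ≤-refl πk) k<o τo
    ... | j , k<j , πj
      with consistent a k j k o k<j k<o (s , πk) πj (s , agree ≤-refl πk) τo k (suc m)
             (agree⇒matched-diagonal agree πk)
             (inj₂ (inj₂ (k , m , _ , _ , refl , refl , at-adjs⁺ π k πk πk₊₁ , τadj , A≈q)))
    ... | inj₁ (_ , inj₁ 1+m≡k)   = <⇒≢ (m<n⇒m<1+n k<m) (sym 1+m≡k)
    ... | inj₁ (_ , inj₂ 1+m≡1+k) = <⇒≢ k<m (sym (suc-injective 1+m≡1+k))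
    ... | inj₂ (inj₁ k≡o , _)     = <⇒≢ k<o k≡o
    ... | inj₂ (inj₂ k≡1+o , _)   = <⇒≢ (m<n⇒m<1+n k<o) k≡1+o

    matched-index-not-after : ∀ {k x x' m q} → AgreeUpTo k → π at k ≡ x → π at suc k ≡ x' →
                              adjs τ at m ≡ q → adj x x' ≈ᴬ q → ¬ k < m
    matched-index-not-after {m = m} agree πk πk₊₁ τadj A≈q k<m with adj-≈-at⇒occ τ m τadj A≈q
    ... | inj₁ τm   = no-later-occurrence agree πk πk₊₁ τadj A≈q k<m k<m τm
    ... | inj₂ τm₊₁ = no-later-occurrence agree πk πk₊₁ τadj A≈q k<m (m<n⇒m<1+n k<m) τm₊₁

    agree-step : ∀ {k x'} → AgreeUpTo k → π at suc k ≡ x' → τ at suc k ≡ x'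
    agree-step {k} agree πk₊₁ with at-≤ π (n≤1+n k) πk₊₁
    ... | x , πk
      with ∈⇒at AdjSetoid (∈-resp-↭ 𝒜π↭𝒜τ (at⇒∈ AdjSetoid k (at-adjs⁺ π k πk πk₊₁)))
    ... | m , q , τadj , A≈q with <-cmp m k
    ... | tri< m<k _ _ = ⊥-elim (matched-index-not-before agree πk πk₊₁ τadj A≈q m<k)
    ... | tri> _ _ k<m = ⊥-elim (matched-index-not-after agree πk πk₊₁ τadj A≈q k<m)
    ... | tri≈ _ refl _ with at-adjs⁻ τ k τadj
    ... | z , w , τk , τk₊₁ , refl with at-functional τ k (agree ≤-refl πk) τk
    ... | refl = subst (λ v → τ at suc k ≡ v) (sym (adj-cancelˡ A≈q)) τk₊₁

    agree : ∀ k → AgreeUpTo k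
    agree zero    {zero} _  π₀ =
      subst (λ v → τ at 0 ≡ v) (at-functional π 0 (chromosome-head cπ) π₀) (chromosome-head cτ)
    agree (suc k) p≤1+k πp with m≤n⇒m<n∨m≡n p≤1+k
    ... | inj₁ (s≤s p≤k) = agree k p≤k πp
    ... | inj₂ refl      = agree-step (agree k) πp

    reconstruct : π ≡ τ
    reconstruct =
      at-pointwise⇒≡ π τ (λ {p} → agree p ≤-refl) (chromosome-sameAdj⇒length≡ cπ cτ 𝒜π↭𝒜τ)

theorem2 : (Σ : Alphabet) → let open Theory Σ in
    (π τ : List SSym) →
    Chromosome π → Chromosome τ → Simple π → Simple τ → Related π τ →
    DpIs2 π → DpIs2 τ →
    (π ≡ τ) ⇔ (SameAdj π τ × (∀ (a : Alphabet.Repeat Σ) → NeighborConsistent π τ a))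
theorem2 𝔸 π τ cπ cτ sπ _ related dπ dτ = mk⇔ forward backward
  where
  open Theory 𝔸
  forward : π ≡ τ → SameAdj π τ × (∀ a → NeighborConsistent π τ a)
  forward refl =
    SetoidPermutation.↭-refl AdjSetoid , λ a → neighborConsistent-refl 𝔸 sπ (proj₁ dπ a)
  backward : SameAdj π τ × (∀ a → NeighborConsistent π τ a) → π ≡ τ
  backward (𝒜π↭𝒜τ , consistent) =
    Reconstruction.reconstruct 𝔸 cπ cτ sπ related (proj₁ dτ) 𝒜π↭𝒜τ consistent
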